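{- Let $\mathbb{T}=(\Sigma,E)$ be an algebraic theory, $(\mathcal{C},i)$ a $\mathbb{T}$-rig category, and $t\colon n\to1$ an arrow of $\mathbf{L}_{\mathbb{T}}$. For arrows $h_1,\dots,h_n\colon X\to Y$ define $t(h_1,\dots,h_n):=t_X;(h_1\oplus\dots\oplus h_n);\nabla^n_Y\colon X\to Y$. Then: (1) $t(h_1,\dots,h_n);g=t(h_1;g,\dots,h_n;g)$ for every $g\colon Y\to Z$; (2) $g;t(h_1,\dots,h_n)=t(g;h_1,\dots,g;h_n)$ for every $g\colon W\to X$; (3) $t(h_1,\dots,h_n)\otimes g=t(h_1\otimes g,\dots,h_n\otimes g)$ for every $g\colon Z\to U$; (4) $g\otimes t(h_1,\dots,h_n)=t(g\otimes h_1,\dots,g\otimes h_n)$ for every $g\colon Z\to U$.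
   Context: Composition is diagrammatic. $\mathbf{L}_{\mathbb{T}}$: Lawvere theory of $\mathbb{T}$ (objects naturals, arrows $n\to m$ tuples of $m$ $\Sigma$-terms in $x_1..x_n$ modulo $E$, composition by substitution, product = addition). A $\mathbb{T}$-rig category is a rig category $\mathcal{C}$ (symmetric monoidal $(\otimes,1)$ with unitor $\lambda_X\colon1\otimes X\to X$, symmetric monoidal $(\oplus,0)$, natural isos $\delta^l,\delta^r$ ($\delta^r_{X,Y,Z}\colon(X\oplus Y)\otimes Z\to(X\otimes Z)\oplus(Y\otimes Z)$), $\lambda^\bullet_X\colon0\otimes X\to0$, $\rho^\bullet$ with Laplaza's axioms) whose $\oplus$ is a finite coproduct with natural coherent monoids $(\nabla_X,¡_X)$, together with a morphism of fc categories $i\colon\mathbf{L}_{\mathbb{T}}^{op}\to\mathcal{C}$ with $d;i=c$ ($d\colon\aleph_0\to\mathbf{L}_{\mathbb{T}}^{op}$ the identity-on-objects fc morphism from the free strict fc category on one object; $c\colon\aleph_0\to\mathcal{C}$, $n\mapsto\bigoplus^n1$). Sums are right-bracketed, $nX:=\bigoplus_{i=1}^nX$. Since $t\colon n\to1$, $i(t)\colon1\to n1$; $t_X:=\lambda_X^{ -1};(i(t)\otimes\mathrm{id}_X);\delta^r_{n,X}\colon X\to nX$, where $\delta^r_{0,X}=\lambda^\bullet_X$, $\delta^r_{1,X}=\lambda_X$, $\delta^r_{n+1,X}=\delta^r_{1,n1,X};(\lambda_X\oplus\delta^r_{n,X})$. $\nabla^n_Y\colon nY\to Y$: $\nabla^0_Y=¡_Y$,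 $\nabla^1_Y=\mathrm{id}_Y$, $\nabla^{n+1}_Y=(\mathrm{id}_Y\oplus\nabla^n_Y);\nabla_Y$. -}

module Defs where

open import Level using (Level; _⊔_) renaming (suc to lsuc)
open import Data.Nat using (ℕ; zero; suc; _+_)
open import Data.Fin using (Fin; zero; suc; splitAt; _↑ˡ_; _↑ʳ_)
open import Data.Sum using (inj₁; inj₂; [_,_])
open import Data.Product using (_×_)
open import Function using (_∘_)
open import Relation.Binary using (IsEquivalence)

-- Categories (hom-setoids), composition is DIAGRAMMATIC: f ⨾ g = "f ; g"

record Category (o ℓ e : Level) : Set (lsuc (o ⊔ ℓ ⊔ e)) where
  infixr 9 _⨾_
  infix 5 _⇒_
  infix 4 _≈_
  field
    Obj : Set o
    _⇒_ : Obj → Obj → Set ℓ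
    _≈_ : ∀ {A B} → A ⇒ B → A ⇒ B → Set e
    ≈-equiv : ∀ {A B} → IsEquivalence (_≈_ {A} {B})
    id : ∀ {A} → A ⇒ A
    _⨾_ : ∀ {A B C} → A ⇒ B → B ⇒ C → A ⇒ C
    assoc : ∀ {A B C D} {f : A ⇒ B} {g : B ⇒ C} {h : C ⇒ D} →
            (f ⨾ g) ⨾ h ≈ f ⨾ (g ⨾ h)
    identityˡ : ∀ {A B} {f : A ⇒ B} → id ⨾ f ≈ f
    identityʳ : ∀ {A B} {f : A ⇒ B} → f ⨾ id ≈ f
    ⨾-resp-≈ : ∀ {A B C} {f f' : A ⇒ B} {g g' : B ⇒ C} →
               f ≈ f' → g ≈ g' → f ⨾ g ≈ f' ⨾ g'

record SymMonoidal {o ℓ e} (𝒞 : Category o ℓ e) : Set (o ⊔ ℓ ⊔ e) where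
  open Category 𝒞
  infixr 10 _⊙_ _⊙₁_
  field
    _⊙_ : Obj → Obj → Obj
    _⊙₁_ : ∀ {A B C D} → A ⇒ B → C ⇒ D → (A ⊙ C) ⇒ (B ⊙ D)
    unit : Obj
    ⊙-id : ∀ {A B} → id {A} ⊙₁ id {B} ≈ id
    ⊙-comp : ∀ {A B C D E F} {f : A ⇒ B} {g : B ⇒ C} {h : D ⇒ E} {k : E ⇒ F} →
             (f ⨾ g) ⊙₁ (h ⨾ k) ≈ (f ⊙₁ h) ⨾ (g ⊙₁ k)
    ⊙-resp-≈ : ∀ {A B C D} {f f' : A ⇒ B} {g g' : C ⇒ D} →
               f ≈ f' → g ≈ g' → f ⊙₁ g ≈ f' ⊙₁ g'
    α : ∀ {A B C} → (A ⊙ B) ⊙ C ⇒ A ⊙ (B ⊙ C)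
    α⁻¹ : ∀ {A B C} → A ⊙ (B ⊙ C) ⇒ (A ⊙ B) ⊙ C
    α-isoˡ : ∀ {A B C} → α {A} {B} {C} ⨾ α⁻¹ ≈ id
    α-isoʳ : ∀ {A B C} → α⁻¹ {A} {B} {C} ⨾ α ≈ id
    α-nat : ∀ {A B C D E F} {f : A ⇒ B} {g : C ⇒ D} {h : E ⇒ F} →
            ((f ⊙₁ g) ⊙₁ h) ⨾ α ≈ α ⨾ (f ⊙₁ (g ⊙₁ h))
    lunit : ∀ {A} → unit ⊙ A ⇒ A
    lunit⁻¹ : ∀ {A} → A ⇒ unit ⊙ A
    lunit-isoˡ : ∀ {A} → lunit {A} ⨾ lunit⁻¹ ≈ id
    lunit-isoʳ : ∀ {A} → lunit⁻¹ {A} ⨾ lunit ≈ id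
    lunit-nat : ∀ {A B} {f : A ⇒ B} → (id ⊙₁ f) ⨾ lunit ≈ lunit ⨾ f
    runit : ∀ {A} → A ⊙ unit ⇒ A
    runit⁻¹ : ∀ {A} → A ⇒ A ⊙ unit
    runit-isoˡ : ∀ {A} → runit {A} ⨾ runit⁻¹ ≈ id
    runit-isoʳ : ∀ {A} → runit⁻¹ {A} ⨾ runit ≈ id
    runit-nat : ∀ {A B} {f : A ⇒ B} → (f ⊙₁ id) ⨾ runit ≈ runit ⨾ f
    σ : ∀ {A B} → A ⊙ B ⇒ B ⊙ A
    σ-nat : ∀ {A B C D} {f : A ⇒ B} {g : C ⇒ D} → (f ⊙₁ g) ⨾ σ ≈ σ ⨾ (g ⊙₁ f)
    σ-inv : ∀ {A B} → σ {A} {B} ⨾ σ ≈ id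
    triangle : ∀ {A B} → α {A} {unit} {B} ⨾ (id ⊙₁ lunit) ≈ runit ⊙₁ id
    pentagon : ∀ {A B C D} →
               (α {A} {B} {C} ⊙₁ id {D}) ⨾ α ⨾ (id ⊙₁ α) ≈ α ⨾ α
    hexagon : ∀ {A B C} →
              α {A} {B} {C} ⨾ σ ⨾ α ≈ (σ ⊙₁ id) ⨾ α ⨾ (id ⊙₁ σ)

module SMOps {o ℓ e} {𝒞 : Category o ℓ e} (M : SymMonoidal 𝒞) where
  open Category 𝒞
  open SymMonoidal M
  mid4 : ∀ {P Q R S} → (P ⊙ Q) ⊙ (R ⊙ S) ⇒ (P ⊙ R) ⊙ (Q ⊙ S)
  mid4 = α ⨾ (id ⊙₁ (α⁻¹ ⨾ (σ ⊙₁ id) ⨾ α)) ⨾ α⁻¹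

record RigAxioms {o ℓ e} (𝒞 : Category o ℓ e)
                 (M⊗ M⊕ : SymMonoidal 𝒞) : Set (o ⊔ ℓ ⊔ e) where
  open Category 𝒞
  open SymMonoidal M⊗ renaming
    ( _⊙_ to _⊗_; _⊙₁_ to _⊗₁_; unit to 𝟙; α to α⊗; α⁻¹ to α⊗⁻¹
    ; lunit to λ⊗; runit to ρ⊗; σ to σ⊗ )
  open SymMonoidal M⊕ renaming
    ( _⊙_ to _⊕_; _⊙₁_ to _⊕₁_; unit to 𝟘; α to α⊕; α⁻¹ to α⊕⁻¹
    ; lunit to λ⊕; runit to ρ⊕; σ to σ⊕ )
  open SMOps M⊕ using (mid4)
  field
    δˡ : ∀ {X Y Z} → X ⊗ (Y ⊕ Z) ⇒ (X ⊗ Y) ⊕ (X ⊗ Z)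
    δˡ⁻¹ : ∀ {X Y Z} → (X ⊗ Y) ⊕ (X ⊗ Z) ⇒ X ⊗ (Y ⊕ Z)
    δˡ-isoˡ : ∀ {X Y Z} → δˡ {X} {Y} {Z} ⨾ δˡ⁻¹ ≈ id
    δˡ-isoʳ : ∀ {X Y Z} → δˡ⁻¹ {X} {Y} {Z} ⨾ δˡ ≈ id
    δˡ-nat : ∀ {X X' Y Y' Z Z'} {f : X ⇒ X'} {g : Y ⇒ Y'} {h : Z ⇒ Z'} →
             (f ⊗₁ (g ⊕₁ h)) ⨾ δˡ ≈ δˡ ⨾ ((f ⊗₁ g) ⊕₁ (f ⊗₁ h))
    δʳ : ∀ {X Y Z} → (X ⊕ Y) ⊗ Z ⇒ (X ⊗ Z) ⊕ (Y ⊗ Z)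
    δʳ⁻¹ : ∀ {X Y Z} → (X ⊗ Z) ⊕ (Y ⊗ Z) ⇒ (X ⊕ Y) ⊗ Z
    δʳ-isoˡ : ∀ {X Y Z} → δʳ {X} {Y} {Z} ⨾ δʳ⁻¹ ≈ id
    δʳ-isoʳ : ∀ {X Y Z} → δʳ⁻¹ {X} {Y} {Z} ⨾ δʳ ≈ id
    δʳ-nat : ∀ {X X' Y Y' Z Z'} {f : X ⇒ X'} {g : Y ⇒ Y'} {h : Z ⇒ Z'} →
             ((f ⊕₁ g) ⊗₁ h) ⨾ δʳ ≈ δʳ ⨾ ((f ⊗₁ h) ⊕₁ (g ⊗₁ h))
    λ• : ∀ {X} → 𝟘 ⊗ X ⇒ 𝟘
    λ•⁻¹ : ∀ {X} → 𝟘 ⇒ 𝟘 ⊗ X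
    λ•-isoˡ : ∀ {X} → λ• {X} ⨾ λ•⁻¹ ≈ id
    λ•-isoʳ : ∀ {X} → λ•⁻¹ {X} ⨾ λ• ≈ id
    λ•-nat : ∀ {X Y} {f : X ⇒ Y} → (id ⊗₁ f) ⨾ λ• ≈ λ•
    ρ• : ∀ {X} → X ⊗ 𝟘 ⇒ 𝟘
    ρ•⁻¹ : ∀ {X} → 𝟘 ⇒ X ⊗ 𝟘
    ρ•-isoˡ : ∀ {X} → ρ• {X} ⨾ ρ•⁻¹ ≈ id
    ρ•-isoʳ : ∀ {X} → ρ•⁻¹ {X} ⨾ ρ• ≈ id
    ρ•-nat : ∀ {X Y} {f : X ⇒ Y} → (f ⊗₁ id) ⨾ ρ• ≈ ρ•
    lap-I : ∀ {A B C} →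
            δʳ {A} {B} {C} ⨾ (σ⊗ ⊕₁ σ⊗) ≈ σ⊗ ⨾ δˡ
    lap-II : ∀ {A B C} →
             (id {A} ⊗₁ σ⊕ {B} {C}) ⨾ δˡ ≈ δˡ ⨾ σ⊕
    lap-III : ∀ {A B C} →
              (σ⊕ {A} {B} ⊗₁ id {C}) ⨾ δʳ ≈ δʳ ⨾ σ⊕
    lap-IV : ∀ {A B C D} →
             (id {A} ⊗₁ α⊕ {B} {C} {D}) ⨾ δˡ ⨾ (id ⊕₁ δˡ) ≈ δˡ ⨾ (δˡ ⊕₁ id) ⨾ α⊕
    lap-V : ∀ {A B C D} →
            (α⊕ {A} {B} {C} ⊗₁ id {D}) ⨾ δʳ ⨾ (id ⊕₁ δʳ) ≈ δʳ ⨾ (δʳ ⊕₁ id) ⨾ α⊕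
    lap-VI : ∀ {A B C D} →
             δˡ {A ⊗ B} {C} {D} ⨾ (α⊗ ⊕₁ α⊗) ≈ α⊗ ⨾ (id ⊗₁ δˡ) ⨾ δˡ
    lap-VII : ∀ {A B C D} →
              (δˡ {A} {B} {C} ⊗₁ id {D}) ⨾ δʳ ⨾ (α⊗ ⊕₁ α⊗) ≈ α⊗ ⨾ (id ⊗₁ δʳ) ⨾ δˡ
    lap-VIII : ∀ {A B C D} →
               (δʳ {A} {B} {C} ⊗₁ id {D}) ⨾ δʳ ⨾ (α⊗ ⊕₁ α⊗) ≈ α⊗ ⨾ δʳ
    lap-IX : ∀ {A B C D} →
             δˡ {A ⊕ B} {C} {D} ⨾ (δʳ ⊕₁ δʳ) ⨾ mid4 ≈ δʳ ⨾ (δˡ ⊕₁ δˡ)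
    lap-X : λ• {𝟘} ≈ ρ• {𝟘}
    lap-XI : ∀ {A B} → α⊗ {𝟘} {A} {B} ⨾ λ• ≈ (λ• ⊗₁ id) ⨾ λ•
    lap-XII : ∀ {A B} → α⊗ {A} {B} {𝟘} ⨾ (id ⊗₁ ρ•) ⨾ ρ• ≈ ρ•
    lap-XIII : ∀ {A B} → α⊗ {A} {𝟘} {B} ⨾ (id ⊗₁ λ•) ⨾ ρ• ≈ (ρ• ⊗₁ id) ⨾ λ•
    lap-XIV : ∀ {A B} → δˡ {A} {𝟘} {B} ⨾ (ρ• ⊕₁ id) ⨾ λ⊕ ≈ id ⊗₁ λ⊕
    lap-XV : ∀ {A B} → δʳ {𝟘} {A} {B} ⨾ (λ• ⊕₁ id) ⨾ λ⊕ ≈ λ⊕ ⊗₁ id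
    lap-XVI : ∀ {A B} → δˡ {A} {B} {𝟘} ⨾ (id ⊕₁ ρ•) ⨾ ρ⊕ ≈ id ⊗₁ ρ⊕
    lap-XVII : ∀ {A B} → δʳ {A} {𝟘} {B} ⨾ (id ⊕₁ λ•) ⨾ ρ⊕ ≈ ρ⊕ ⊗₁ id
    lap-XVIII : ρ• {𝟙} ≈ λ⊗ {𝟘}
    lap-XIX : λ• {𝟙} ≈ ρ⊗ {𝟘}
    lap-XX : ∀ {A B} → δˡ {𝟙} {A} {B} ⨾ (λ⊗ ⊕₁ λ⊗) ≈ λ⊗
    lap-XXI : ∀ {A B} → δʳ {A} {B} {𝟙} ⨾ (ρ⊗ ⊕₁ ρ⊗) ≈ ρ⊗
    lap-XXII : ∀ {A} → σ⊗ {A} {𝟘} ⨾ λ• ≈ ρ•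
    lap-XXIII : ∀ {A B} → δˡ {𝟘} {A} {B} ⨾ (λ• ⊕₁ λ•) ⨾ λ⊕ ≈ λ•
    lap-XXIV : ∀ {A B} → δʳ {A} {B} {𝟘} ⨾ (ρ• ⊕₁ ρ•) ⨾ λ⊕ ≈ ρ•

-- ⊕ is a finite coproduct: natural, coherent commutative monoids (∇, ¡)

record FC {o ℓ e} (𝒞 : Category o ℓ e) (M : SymMonoidal 𝒞) : Set (o ⊔ ℓ ⊔ e) where
  open Category 𝒞
  open SymMonoidal M
  open SMOps M using (mid4)
  field
    ∇ : ∀ {X} → X ⊙ X ⇒ X
    ¡ : ∀ {X} → unit ⇒ X
    ∇-assoc : ∀ {X} → (∇ {X} ⊙₁ id) ⨾ ∇ ≈ α ⨾ (id ⊙₁ ∇) ⨾ ∇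
    ∇-unitˡ : ∀ {X} → (¡ ⊙₁ id {X}) ⨾ ∇ ≈ lunit
    ∇-unitʳ : ∀ {X} → (id {X} ⊙₁ ¡) ⨾ ∇ ≈ runit
    ∇-comm : ∀ {X} → σ ⨾ ∇ {X} ≈ ∇
    ∇-nat : ∀ {X Y} {f : X ⇒ Y} → ∇ ⨾ f ≈ (f ⊙₁ f) ⨾ ∇
    ¡-nat : ∀ {X Y} {f : X ⇒ Y} → ¡ ⨾ f ≈ ¡
    ∇-coh : ∀ {X Y} → ∇ {X ⊙ Y} ≈ mid4 ⨾ (∇ ⊙₁ ∇)
    ∇-coh₀ : ∇ {unit} ≈ lunit
    ¡-coh : ∀ {X Y} → ¡ {X ⊙ Y} ≈ lunit⁻¹ ⨾ (¡ ⊙₁ ¡)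
    ¡-coh₀ : ¡ {unit} ≈ id

module FCOps {o ℓ e} {𝒞 : Category o ℓ e} (M : SymMonoidal 𝒞) (fc : FC 𝒞 M) where
  open Category 𝒞
  open SymMonoidal M
  open FC fc

  infixr 20 _·_
  _·_ : ℕ → Obj → Obj
  zero · X = unit
  suc zero · X = X
  suc (suc n) · X = X ⊙ (suc n · X)

  ⨁ : ∀ {n X Y} → (Fin n → X ⇒ Y) → n · X ⇒ n · Y
  ⨁ {zero} h = id
  ⨁ {suc zero} h = h zero
  ⨁ {suc (suc n)} h = h zero ⊙₁ ⨁ {suc n} (h ∘ suc)

  ∇ⁿ : ∀ n {Y} → n · Y ⇒ Y
  ∇ⁿ zero = ¡
  ∇ⁿ (suc zero) = id
  ∇ⁿ (suc (suc n)) = (id ⊙₁ ∇ⁿ (suc n)) ⨾ ∇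

  ι : ∀ {n X} → Fin n → X ⇒ n · X
  ι {suc zero} zero = id
  ι {suc (suc n)} zero = runit⁻¹ ⨾ (id ⊙₁ ¡)
  ι {suc (suc n)} (suc k) = lunit⁻¹ ⨾ (¡ ⊙₁ ι k)

  -- action of c on an arrow f : n → m of ℵ₀ (a function Fin n → Fin m)
  c₁ : ∀ {n m X} → (Fin n → Fin m) → n · X ⇒ m · X
  c₁ {n} f = ⨁ (λ j → ι (f j)) ⨾ ∇ⁿ n

  -- canonical structure isomorphism  n·X ⊕ m·X ≅ (n+m)·X  of c
  φc : ∀ n m {X} → (n · X) ⊙ (m · X) ⇒ (n + m) · X
  φc zero m = lunit
  φc (suc zero) zero = runit
  φc (suc zero) (suc m) = id
  φc (suc (suc n)) m = α ⨾ (id ⊙₁ φc (suc n) m)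

record Signature : Set₁ where
  field
    Op : Set
    arity : Op → ℕ
open Signature public

data Term (S : Signature) (n : ℕ) : Set where
  var : Fin n → Term S n
  op : (o : Op S) → (Fin (arity S o) → Term S n) → Term S n

sub : ∀ {S n m} → (Fin n → Term S m) → Term S n → Term S m
sub s (var x) = s x
sub s (op o ts) = op o (λ k → sub s (ts k))

ren : ∀ {S n m} → (Fin n → Fin m) → Term S n → Term S m
ren f = sub (var ∘ f)

record Theory : Set₁ where
  field
    sig : Signature
    Ax : Set
    axVars : Ax → ℕ
    axLhs axRhs : (a : Ax) → Term sig (axVars a)
open Theory public

data _⊢_≈ₜ_ (T : Theory) {n : ℕ} : Term (sig T) n → Term (sig T) n → Set where
  ≈-refl : ∀ {s} → T ⊢ s ≈ₜ s
  ≈-sym : ∀ {s u} → T ⊢ s ≈ₜ u → T ⊢ u ≈ₜ s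
  ≈-trans : ∀ {s u v} → T ⊢ s ≈ₜ u → T ⊢ u ≈ₜ v → T ⊢ s ≈ₜ v
  ≈-cong : ∀ (o : Op (sig T)) {ts us : Fin (arity (sig T) o) → Term (sig T) n} →
           (∀ k → T ⊢ ts k ≈ₜ us k) → T ⊢ op o ts ≈ₜ op o us
  ≈-ax : ∀ (a : Ax T) (s : Fin (axVars T a) → Term (sig T) n) →
         T ⊢ sub s (axLhs T a) ≈ₜ sub s (axRhs T a)

-- Arrows n → m of L_T^op  =  arrows m → n of L_T  =  n-tuples of terms in m variables.
LOp : Theory → ℕ → ℕ → Set
LOp T n m = Fin n → Term (sig T) m

-- An arrow t : n → 1 of L_T (a single term in n variables)
LArr : Theory → ℕ → ℕ → Set
LArr T n m = LOp T m n

module LOps (T : Theory) where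
  infix 4 _≈L_
  _≈L_ : ∀ {n m} → LOp T n m → LOp T n m → Set
  f ≈L g = ∀ j → T ⊢ f j ≈ₜ g j

  idL : ∀ {n} → LOp T n n
  idL = var

  -- composition in L_T^op (diagrammatic): substitution
  _⨾L_ : ∀ {n m k} → LOp T n m → LOp T m k → LOp T n k
  (f ⨾L g) j = sub g (f j)

  _⊕L_ : ∀ {n n' m m'} → LOp T n m → LOp T n' m' → LOp T (n + n') (m + m')
  _⊕L_ {n} {n'} {m} {m'} f g j =
    [ (λ a → ren (_↑ˡ m') (f a)) , (λ b → ren (m ↑ʳ_) (g b)) ] (splitAt n j)

  -- the identity-on-objects fc morphism d : ℵ₀ → L_T^op
  dL : ∀ {n m} → (Fin n → Fin m) → LOp T n m
  dL f = var ∘ f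

swapF : ∀ n m → Fin (n + m) → Fin (m + n)
swapF n m j = [ (λ a → m ↑ʳ a) , (λ b → b ↑ˡ n) ] (splitAt n j)

assocF : ∀ n m k → Fin ((n + m) + k) → Fin (n + (m + k))
assocF n m k j =
  [ (λ a → [ (λ x → x ↑ˡ (m + k)) , (λ y → n ↑ʳ (y ↑ˡ k)) ] (splitAt n a))
  , (λ z → n ↑ʳ (m ↑ʳ z)) ] (splitAt (n + m) j)

runitF : ∀ n → Fin (n + 0) → Fin n
runitF n j = [ (λ a → a) , (λ ()) ] (splitAt n j)

codiagF : ∀ n → Fin (n + n) → Fin n
codiagF n j = [ (λ a → a) , (λ a → a) ] (splitAt n j)

bangF : ∀ n → Fin 0 → Fin n
bangF n ()

-- Morphism of fc categories  i : L_T^op → 𝒞  with  d ; i = c.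
-- Since d ; i = c, i is n ↦ n·1 on objects and its monoidal structure
-- isomorphisms are those of c (φc); these are built in.

record TMorphism (T : Theory) {o ℓ e} (𝒞 : Category o ℓ e)
                 (M⊕ : SymMonoidal 𝒞) (fc : FC 𝒞 M⊕) (I : Category.Obj 𝒞)
                 : Set (o ⊔ ℓ ⊔ e) where
  open Category 𝒞
  open SymMonoidal M⊕
  open FC fc
  open FCOps M⊕ fc
  open LOps T
  field
    map : ∀ {n m} → LOp T n m → n · I ⇒ m · I
    map-resp : ∀ {n m} {f g : LOp T n m} → f ≈L g → map f ≈ map g
    map-id : ∀ {n} → map (idL {n}) ≈ id
    map-comp : ∀ {n m k} {f : LOp T n m} {g : LOp T m k} →
               map (f ⨾L g) ≈ map f ⨾ map g
    -- strong monoidal (structure maps φc, unit map id)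
    map-⊕ : ∀ {n n' m m'} {f : LOp T n m} {g : LOp T n' m'} →
            (map f ⊙₁ map g) ⨾ φc m m' ≈ φc n n' ⨾ map (f ⊕L g)
    map-α : ∀ {n m k} →
            (φc n m ⊙₁ id) ⨾ φc (n + m) k ⨾ map (dL (assocF n m k))
              ≈ α ⨾ (id ⊙₁ φc m k) ⨾ φc n (m + k)
    map-λ : ∀ {n} → (id ⊙₁ id) ⨾ φc 0 n ⨾ map (idL {n}) ≈ lunit
    map-ρ : ∀ {n} → (id ⊙₁ id) ⨾ φc n 0 ⨾ map (dL (runitF n)) ≈ runit
    map-σ : ∀ {n m} → σ ⨾ φc m n ≈ φc n m ⨾ map (dL (swapF n m))
    map-∇ : ∀ {n} → φc n n ⨾ map (dL (codiagF n)) ≈ ∇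
    map-¡ : ∀ {n} → id ⨾ map (dL (bangF n)) ≈ ¡
    map-d : ∀ {n m} (f : Fin n → Fin m) → map (dL f) ≈ c₁ f

record TRig (T : Theory) (o ℓ e : Level) : Set (lsuc (o ⊔ ℓ ⊔ e)) where
  field
    𝒞 : Category o ℓ e
    M⊗ : SymMonoidal 𝒞
    M⊕ : SymMonoidal 𝒞
    rig : RigAxioms 𝒞 M⊗ M⊕
    fc : FC 𝒞 M⊕
    i : TMorphism T 𝒞 M⊕ fc (SymMonoidal.unit M⊗)

module TOps {T : Theory} {o ℓ e} (R : TRig T o ℓ e) where
  open TRig R
  open Category 𝒞 public
  open SymMonoidal M⊗ public renaming
    ( _⊙_ to _⊗_; _⊙₁_ to _⊗₁_; unit to 𝟙; lunit to λ⊗; lunit⁻¹ to λ⊗⁻¹ )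
    using ()
  open SymMonoidal M⊕ public renaming ( _⊙_ to _⊕_; _⊙₁_ to _⊕₁_ ) using ()
  open RigAxioms rig using (δʳ; λ•)
  open FCOps M⊕ fc public using (_·_; ⨁; ∇ⁿ)
  open TMorphism i using (map)

  δʳⁿ : ∀ n {X} → (n · 𝟙) ⊗ X ⇒ n · X
  δʳⁿ zero = λ•
  δʳⁿ (suc zero) = λ⊗
  δʳⁿ (suc (suc n)) = δʳ ⨾ (λ⊗ ⊕₁ δʳⁿ (suc n))

  tX : ∀ {n} (t : LArr T n 1) {X} → X ⇒ n · X
  tX {n} t = λ⊗⁻¹ ⨾ (map t ⊗₁ id) ⨾ δʳⁿ n

  tApp : ∀ {n} (t : LArr T n 1) {X Y} → (Fin n → X ⇒ Y) → X ⇒ Y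
  tApp {n} t h = tX t ⨾ ⨁ h ⨾ ∇ⁿ n

-- t(h₁,…,hₙ) is t_X followed by ⨁h and the codiagonal ∇ⁿ, so (1) and (2) are the
-- naturality of ∇ⁿ and of t_X. For (3), the functor - ⊗ Z preserves the coproduct
-- injections (Laplaza XV, XVII) and hence the codiagonal, so ∇ⁿ ⊗ Z is the n-fold
-- distributor followed by ∇ⁿ; and t_X ⊗ Z followed by that distributor is t_{X⊗Z},
-- by Laplaza VIII, XI and Kelly's lemma α ⨾ λ = λ ⊗ id. (4) is (3) conjugated by the
-- symmetry of ⊗, which passes inside by (1) and (2).
module Submission where

open import Data.Nat using (zero; suc)
open import Data.Fin using (Fin; zero; suc)
open import Data.Product using (_×_; _,_)
open import Function using (_∘_)
open import Relation.Binary.Bundles using (Setoid)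
import Relation.Binary.Reasoning.Setoid as SetoidReasoning
open import Defs

module CategoryProperties {o ℓ e} (𝒞 : Category o ℓ e) where
  open Category 𝒞

  hom-setoid : Obj → Obj → Setoid ℓ e
  hom-setoid A B = record { Carrier = A ⇒ B ; _≈_ = _≈_ ; isEquivalence = ≈-equiv }

  module _ {A B : Obj} where
    open Setoid (hom-setoid A B) public using (refl; sym; trans)
    open SetoidReasoning (hom-setoid A B) public

  infixr 3 _⟨≈⟩_
  _⟨≈⟩_ : ∀ {A B} {f g h : A ⇒ B} → f ≈ g → g ≈ h → f ≈ h
  _⟨≈⟩_ = trans

  infixr 4 _⟩⨾⟨_
  _⟩⨾⟨_ : ∀ {A B C} {f f' : A ⇒ B} {g g' : B ⇒ C} →
          f ≈ f' → g ≈ g' → f ⨾ g ≈ f' ⨾ g'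
  _⟩⨾⟨_ = ⨾-resp-≈

  sym-assoc : ∀ {A B C D} {f : A ⇒ B} {g : B ⇒ C} {h : C ⇒ D} →
              f ⨾ (g ⨾ h) ≈ (f ⨾ g) ⨾ h
  sym-assoc = sym assoc

  id-comm : ∀ {A B} {f : A ⇒ B} → f ⨾ id ≈ id ⨾ f
  id-comm = identityʳ ⟨≈⟩ sym identityˡ

  cancelˡ : ∀ {A B C} {u : A ⇒ B} {v : B ⇒ A} {h : A ⇒ C} →
            u ⨾ v ≈ id → u ⨾ (v ⨾ h) ≈ h
  cancelˡ uv = sym-assoc ⟨≈⟩ (uv ⟩⨾⟨ refl) ⟨≈⟩ identityˡ

  move-isoʳ : ∀ {A B C} {a : A ⇒ B} {b : A ⇒ C} {u : B ⇒ C} {v : C ⇒ B} →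
              a ⨾ u ≈ b → u ⨾ v ≈ id → a ≈ b ⨾ v
  move-isoʳ au uv = sym identityʳ ⟨≈⟩ (refl ⟩⨾⟨ sym uv) ⟨≈⟩ sym-assoc ⟨≈⟩ (au ⟩⨾⟨ refl)

  cancel-split-epi : ∀ {A B C} {u : A ⇒ B} {v : B ⇒ A} {f g : B ⇒ C} →
                     v ⨾ u ≈ id → u ⨾ f ≈ u ⨾ g → f ≈ g
  cancel-split-epi vu p = sym (cancelˡ vu) ⟨≈⟩ (refl ⟩⨾⟨ p) ⟨≈⟩ cancelˡ vu

  inverse-square : ∀ {A B C D} {u : A ⇒ B} {v : B ⇒ A} {u' : C ⇒ D} {v' : D ⇒ C}
                     {f : A ⇒ C} {g : B ⇒ D} →
                   u' ⨾ v' ≈ id → v ⨾ u ≈ id → f ⨾ u' ≈ u ⨾ g → v ⨾ f ≈ g ⨾ v'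
  inverse-square {u = u} {v} {u'} {v'} {f} {g} u'v' vu square = begin
    v ⨾ f                ≈⟨ sym identityʳ ⟨≈⟩ (refl ⟩⨾⟨ sym u'v') ⟩
    (v ⨾ f) ⨾ (u' ⨾ v')  ≈⟨ assoc ⟨≈⟩ (refl ⟩⨾⟨ sym-assoc) ⟩
    v ⨾ ((f ⨾ u') ⨾ v')  ≈⟨ refl ⟩⨾⟨ ((square ⟩⨾⟨ refl) ⟨≈⟩ assoc) ⟩
    v ⨾ (u ⨾ (g ⨾ v'))   ≈⟨ cancelˡ vu ⟩
    g ⨾ v'               ∎

module SymMonoidalProperties {o ℓ e} {𝒞 : Category o ℓ e} (M : SymMonoidal 𝒞) where
  open Category 𝒞
  open SymMonoidal M
  open CategoryProperties 𝒞

  infixr 6 _⟩⊙⟨_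
  _⟩⊙⟨_ : ∀ {A B C D} {f f' : A ⇒ B} {g g' : C ⇒ D} →
          f ≈ f' → g ≈ g' → f ⊙₁ g ≈ f' ⊙₁ g'
  _⟩⊙⟨_ = ⊙-resp-≈

  ⊙-square : ∀ {A B C D A' B' C' D'} {a : A ⇒ B} {b : B ⇒ C} {c : A ⇒ D} {d : D ⇒ C}
               {a' : A' ⇒ B'} {b' : B' ⇒ C'} {c' : A' ⇒ D'} {d' : D' ⇒ C'} →
             a ⨾ b ≈ c ⨾ d → a' ⨾ b' ≈ c' ⨾ d' →
             (a ⊙₁ a') ⨾ (b ⊙₁ b') ≈ (c ⊙₁ c') ⨾ (d ⊙₁ d')
  ⊙-square p q = sym ⊙-comp ⟨≈⟩ (p ⟩⊙⟨ q) ⟨≈⟩ ⊙-comp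

  serializeˡ : ∀ {A B C D} {f : A ⇒ B} {g : C ⇒ D} → f ⊙₁ g ≈ (f ⊙₁ id) ⨾ (id ⊙₁ g)
  serializeˡ = (sym identityʳ ⟩⊙⟨ sym identityˡ) ⟨≈⟩ ⊙-comp

  serializeʳ : ∀ {A B C D} {f : A ⇒ B} {g : C ⇒ D} → f ⊙₁ g ≈ (id ⊙₁ g) ⨾ (f ⊙₁ id)
  serializeʳ = (sym identityˡ ⟩⊙⟨ sym identityʳ) ⟨≈⟩ ⊙-comp

  ⊙id-comp : ∀ {A B C D} {f : A ⇒ B} {g : B ⇒ C} →
             (f ⨾ g) ⊙₁ id {D} ≈ (f ⊙₁ id) ⨾ (g ⊙₁ id)
  ⊙id-comp = (refl ⟩⊙⟨ sym identityˡ) ⟨≈⟩ ⊙-comp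

  id⊙-comp : ∀ {A B C D} {f : A ⇒ B} {g : B ⇒ C} →
             id {D} ⊙₁ (f ⨾ g) ≈ (id ⊙₁ f) ⨾ (id ⊙₁ g)
  id⊙-comp = (sym identityˡ ⟩⊙⟨ refl) ⟨≈⟩ ⊙-comp

  ⊙id-inverse : ∀ {A B D} {f : A ⇒ B} {g : B ⇒ A} →
                f ⨾ g ≈ id → (f ⊙₁ id {D}) ⨾ (g ⊙₁ id) ≈ id
  ⊙id-inverse fg = sym ⊙id-comp ⟨≈⟩ (fg ⟩⊙⟨ refl) ⟨≈⟩ ⊙-id

  α⁻¹-nat : ∀ {A B C D E F} {f : A ⇒ B} {g : C ⇒ D} {h : E ⇒ F} →
            (f ⊙₁ (g ⊙₁ h)) ⨾ α⁻¹ ≈ α⁻¹ ⨾ ((f ⊙₁ g) ⊙₁ h)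
  α⁻¹-nat = sym (inverse-square α-isoˡ α-isoʳ α-nat)

  lunit⁻¹-nat : ∀ {A B} {f : A ⇒ B} → f ⨾ lunit⁻¹ ≈ lunit⁻¹ ⨾ (id ⊙₁ f)
  lunit⁻¹-nat = sym (inverse-square lunit-isoˡ lunit-isoʳ lunit-nat)

  σ-conjugate : ∀ {A B C D} {f : A ⇒ B} {g : C ⇒ D} → g ⊙₁ f ≈ σ ⨾ (f ⊙₁ g) ⨾ σ
  σ-conjugate = sym identityʳ ⟨≈⟩ (refl ⟩⨾⟨ sym σ-inv) ⟨≈⟩ sym-assoc ⟨≈⟩ (σ-nat ⟩⨾⟨ refl) ⟨≈⟩ assoc

  id⊙-faithful : ∀ {A B} {f g : A ⇒ B} → id {unit} ⊙₁ f ≈ id ⊙₁ g → f ≈ g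
  id⊙-faithful p = cancel-split-epi lunit-isoʳ (sym lunit-nat ⟨≈⟩ (p ⟩⨾⟨ refl) ⟨≈⟩ lunit-nat)

  -- Kelly's lemma: both sides agree after whiskering with the unit and
  -- precomposing with an associator, by the pentagon and two triangles.
  α-lunit : ∀ {A B} → α {unit} {A} {B} ⨾ lunit ≈ lunit ⊙₁ id
  α-lunit {A} {B} = id⊙-faithful (cancel-split-epi P⁻¹-P (via-pentagon ⟨≈⟩ sym via-α-nat))
    where
    P : ((unit ⊙ unit) ⊙ A) ⊙ B ⇒ unit ⊙ ((unit ⊙ A) ⊙ B)
    P = (α ⊙₁ id) ⨾ α
    P⁻¹-P : (α⁻¹ ⨾ (α⁻¹ ⊙₁ id)) ⨾ P ≈ id
    P⁻¹-P = assoc ⟨≈⟩ (refl ⟩⨾⟨ cancelˡ (⊙id-inverse α-isoʳ)) ⟨≈⟩ α-isoʳ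
    via-pentagon : P ⨾ (id ⊙₁ (α ⨾ lunit)) ≈ ((runit ⊙₁ id) ⊙₁ id) ⨾ α
    via-pentagon = begin
      P ⨾ (id ⊙₁ (α ⨾ lunit))
        ≈⟨ refl ⟩⨾⟨ id⊙-comp ⟩
      ((α ⊙₁ id) ⨾ α) ⨾ ((id ⊙₁ α) ⨾ (id ⊙₁ lunit))
        ≈⟨ assoc ⟨≈⟩ (refl ⟩⨾⟨ sym-assoc) ⟨≈⟩ sym-assoc ⟩
      ((α ⊙₁ id) ⨾ α ⨾ (id ⊙₁ α)) ⨾ (id ⊙₁ lunit)
        ≈⟨ pentagon ⟩⨾⟨ refl ⟨≈⟩ assoc ⟩
      α ⨾ (α ⨾ (id ⊙₁ lunit))
        ≈⟨ refl ⟩⨾⟨ (triangle ⟨≈⟩ (refl ⟩⊙⟨ sym ⊙-id)) ⟩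
      α ⨾ (runit ⊙₁ (id ⊙₁ id))
        ≈⟨ sym α-nat ⟩
      ((runit ⊙₁ id) ⊙₁ id) ⨾ α
        ∎
    via-α-nat : P ⨾ (id ⊙₁ (lunit ⊙₁ id)) ≈ ((runit ⊙₁ id) ⊙₁ id) ⨾ α
    via-α-nat = begin
      P ⨾ (id ⊙₁ (lunit ⊙₁ id))
        ≈⟨ assoc ⟨≈⟩ (refl ⟩⨾⟨ sym α-nat) ⟨≈⟩ sym-assoc ⟩
      ((α ⊙₁ id) ⨾ ((id ⊙₁ lunit) ⊙₁ id)) ⨾ α
        ≈⟨ sym ⊙id-comp ⟩⨾⟨ refl ⟩
      ((α ⨾ (id ⊙₁ lunit)) ⊙₁ id) ⨾ α
        ≈⟨ (triangle ⟩⊙⟨ refl) ⟩⨾⟨ refl ⟩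
      ((runit ⊙₁ id) ⊙₁ id) ⨾ α
        ∎

  lunit⁻¹-α : ∀ {A B} → (lunit⁻¹ ⊙₁ id) ⨾ α {unit} {A} {B} ≈ lunit⁻¹
  lunit⁻¹-α = begin
    (lunit⁻¹ ⊙₁ id) ⨾ α
      ≈⟨ move-isoʳ assoc lunit-isoˡ ⟩
    ((lunit⁻¹ ⊙₁ id) ⨾ α ⨾ lunit) ⨾ lunit⁻¹
      ≈⟨ (refl ⟩⨾⟨ α-lunit) ⟩⨾⟨ refl ⟩
    ((lunit⁻¹ ⊙₁ id) ⨾ (lunit ⊙₁ id)) ⨾ lunit⁻¹
      ≈⟨ ⊙id-inverse lunit-isoʳ ⟩⨾⟨ refl ⟨≈⟩ identityˡ ⟩
    lunit⁻¹
      ∎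

module CoproductProperties {o ℓ e} {𝒞 : Category o ℓ e} (M : SymMonoidal 𝒞) (fc : FC 𝒞 M) where
  open Category 𝒞
  open SymMonoidal M
  open SMOps M
  open FC fc
  open CategoryProperties 𝒞
  open SymMonoidalProperties M

  ¡-unique : ∀ {A} (f : unit ⇒ A) → f ≈ ¡
  ¡-unique f = sym identityˡ ⟨≈⟩ (sym ¡-coh₀ ⟩⨾⟨ refl) ⟨≈⟩ ¡-nat

  σ-unit : σ {unit} {unit} ≈ id
  σ-unit = through-unit σ ⟨≈⟩ sym (through-unit id)
    where
    through-unit : (f : unit ⊙ unit ⇒ unit ⊙ unit) → f ≈ lunit ⨾ ¡
    through-unit f = sym (cancelˡ lunit-isoˡ) ⟨≈⟩ (refl ⟩⨾⟨ ¡-unique _)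

  exchange : ∀ {Q R S} → Q ⊙ (R ⊙ S) ⇒ R ⊙ (Q ⊙ S)
  exchange = α⁻¹ ⨾ (σ ⊙₁ id) ⨾ α

  exchange-nat : ∀ {A B C D E F} {f : A ⇒ B} {g : C ⇒ D} {h : E ⇒ F} →
                 (f ⊙₁ (g ⊙₁ h)) ⨾ exchange ≈ exchange ⨾ (g ⊙₁ (f ⊙₁ h))
  exchange-nat {f = f} {g} {h} = begin
    (f ⊙₁ (g ⊙₁ h)) ⨾ α⁻¹ ⨾ (σ ⊙₁ id) ⨾ α      ≈⟨ sym-assoc ⟨≈⟩ (α⁻¹-nat ⟩⨾⟨ refl) ⟨≈⟩ assoc ⟩
    α⁻¹ ⨾ ((f ⊙₁ g) ⊙₁ h) ⨾ (σ ⊙₁ id) ⨾ α      ≈⟨ refl ⟩⨾⟨ sym-assoc ⟩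
    α⁻¹ ⨾ (((f ⊙₁ g) ⊙₁ h) ⨾ (σ ⊙₁ id)) ⨾ α    ≈⟨ refl ⟩⨾⟨ ⊙-square σ-nat id-comm ⟩⨾⟨ refl ⟩
    α⁻¹ ⨾ ((σ ⊙₁ id) ⨾ ((g ⊙₁ f) ⊙₁ h)) ⨾ α    ≈⟨ refl ⟩⨾⟨ (assoc ⟨≈⟩ (refl ⟩⨾⟨ α-nat)) ⟩
    α⁻¹ ⨾ (σ ⊙₁ id) ⨾ α ⨾ (g ⊙₁ (f ⊙₁ h))      ≈⟨ refl ⟩⨾⟨ sym-assoc ⟨≈⟩ sym-assoc ⟩
    exchange ⨾ (g ⊙₁ (f ⊙₁ h))                ∎

  mid4-nat : ∀ {A A' B B' C C' D D'} {f : A ⇒ A'} {g : B ⇒ B'} {h : C ⇒ C'} {k : D ⇒ D'} →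
             ((f ⊙₁ g) ⊙₁ (h ⊙₁ k)) ⨾ mid4 ≈ mid4 ⨾ ((f ⊙₁ h) ⊙₁ (g ⊙₁ k))
  mid4-nat {f = f} {g} {h} {k} = begin
    ((f ⊙₁ g) ⊙₁ (h ⊙₁ k)) ⨾ α ⨾ (id ⊙₁ exchange) ⨾ α⁻¹
      ≈⟨ sym-assoc ⟨≈⟩ (α-nat ⟩⨾⟨ refl) ⟨≈⟩ assoc ⟩
    α ⨾ (f ⊙₁ (g ⊙₁ (h ⊙₁ k))) ⨾ (id ⊙₁ exchange) ⨾ α⁻¹
      ≈⟨ refl ⟩⨾⟨ (sym-assoc ⟨≈⟩ (⊙-square id-comm exchange-nat ⟩⨾⟨ refl)) ⟩
    α ⨾ ((id ⊙₁ exchange) ⨾ (f ⊙₁ (h ⊙₁ (g ⊙₁ k)))) ⨾ α⁻¹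
      ≈⟨ refl ⟩⨾⟨ (assoc ⟨≈⟩ (refl ⟩⨾⟨ α⁻¹-nat)) ⟩
    α ⨾ (id ⊙₁ exchange) ⨾ α⁻¹ ⨾ ((f ⊙₁ h) ⊙₁ (g ⊙₁ k))
      ≈⟨ refl ⟩⨾⟨ sym-assoc ⟨≈⟩ sym-assoc ⟩
    mid4 ⨾ ((f ⊙₁ h) ⊙₁ (g ⊙₁ k))
      ∎

  mid4-unit : ∀ {C D} → mid4 {C} {unit} {unit} {D} ≈ id
  mid4-unit = begin
    α ⨾ (id ⊙₁ exchange) ⨾ α⁻¹   ≈⟨ refl ⟩⨾⟨ ((refl ⟩⊙⟨ exchange-unit) ⟨≈⟩ ⊙-id) ⟩⨾⟨ refl ⟩
    α ⨾ id ⨾ α⁻¹                 ≈⟨ refl ⟩⨾⟨ identityˡ ⟩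
    α ⨾ α⁻¹                      ≈⟨ α-isoˡ ⟩
    id                           ∎
    where
    exchange-unit : ∀ {S} → exchange {unit} {unit} {S} ≈ id
    exchange-unit = begin
      α⁻¹ ⨾ (σ ⊙₁ id) ⨾ α   ≈⟨ refl ⟩⨾⟨ ((σ-unit ⟩⊙⟨ refl) ⟨≈⟩ ⊙-id) ⟩⨾⟨ refl ⟩
      α⁻¹ ⨾ id ⨾ α          ≈⟨ refl ⟩⨾⟨ identityˡ ⟩
      α⁻¹ ⨾ α               ≈⟨ α-isoʳ ⟩
      id                    ∎

  ι₁ : ∀ {C D} → C ⇒ C ⊙ D
  ι₁ = runit⁻¹ ⨾ (id ⊙₁ ¡)

  ι₂ : ∀ {C D} → D ⇒ C ⊙ D
  ι₂ = lunit⁻¹ ⨾ (¡ ⊙₁ id)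

  ι₁-∇ : ∀ {C} → ι₁ {C} {C} ⨾ ∇ ≈ id
  ι₁-∇ = assoc ⟨≈⟩ (refl ⟩⨾⟨ ∇-unitʳ) ⟨≈⟩ runit-isoʳ

  ι₂-∇ : ∀ {C} → ι₂ {C} {C} ⨾ ∇ ≈ id
  ι₂-∇ = assoc ⟨≈⟩ (refl ⟩⨾⟨ ∇-unitˡ) ⟨≈⟩ lunit-isoʳ

  ι₁⊙ι₂-∇ : ∀ {C D} → (ι₁ {C} {D} ⊙₁ ι₂ {C} {D}) ⨾ ∇ ≈ id
  ι₁⊙ι₂-∇ = begin
    (ι₁ ⊙₁ ι₂) ⨾ ∇
      ≈⟨ ⊙-comp ⟩⨾⟨ ∇-coh ⟩
    ((runit⁻¹ ⊙₁ lunit⁻¹) ⨾ ((id ⊙₁ ¡) ⊙₁ (¡ ⊙₁ id))) ⨾ mid4 ⨾ (∇ ⊙₁ ∇)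
      ≈⟨ assoc ⟨≈⟩ (refl ⟩⨾⟨ (sym-assoc ⟨≈⟩ (mid4-nat ⟩⨾⟨ refl) ⟨≈⟩ assoc)) ⟩
    (runit⁻¹ ⊙₁ lunit⁻¹) ⨾ mid4 ⨾ ((id ⊙₁ ¡) ⊙₁ (¡ ⊙₁ id)) ⨾ (∇ ⊙₁ ∇)
      ≈⟨ refl ⟩⨾⟨ ((mid4-unit ⟩⨾⟨ (sym ⊙-comp ⟨≈⟩ (∇-unitʳ ⟩⊙⟨ ∇-unitˡ))) ⟨≈⟩ identityˡ) ⟩
    (runit⁻¹ ⊙₁ lunit⁻¹) ⨾ (runit ⊙₁ lunit)
      ≈⟨ sym ⊙-comp ⟨≈⟩ (runit-isoʳ ⟩⊙⟨ lunit-isoʳ) ⟨≈⟩ ⊙-id ⟩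
    id
      ∎

  copair-η : ∀ {C D E} (f : C ⊙ D ⇒ E) → f ≈ ((ι₁ ⨾ f) ⊙₁ (ι₂ ⨾ f)) ⨾ ∇
  copair-η f = begin
    f                            ≈⟨ sym identityˡ ⟨≈⟩ (sym ι₁⊙ι₂-∇ ⟩⨾⟨ refl) ⟩
    ((ι₁ ⊙₁ ι₂) ⨾ ∇) ⨾ f         ≈⟨ assoc ⟨≈⟩ (refl ⟩⨾⟨ ∇-nat) ⟩
    (ι₁ ⊙₁ ι₂) ⨾ (f ⊙₁ f) ⨾ ∇    ≈⟨ sym-assoc ⟨≈⟩ (sym ⊙-comp ⟩⨾⟨ refl) ⟩
    ((ι₁ ⨾ f) ⊙₁ (ι₂ ⨾ f)) ⨾ ∇   ∎

  ∇-unique : ∀ {C} {f : C ⊙ C ⇒ C} → ι₁ ⨾ f ≈ id → ι₂ ⨾ f ≈ id → f ≈ ∇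
  ∇-unique {f = f} ι₁f ι₂f = copair-η f ⟨≈⟩ ((ι₁f ⟩⊙⟨ ι₂f) ⟨≈⟩ ⊙-id) ⟩⨾⟨ refl ⟨≈⟩ identityˡ

module SumProperties {o ℓ e} {𝒞 : Category o ℓ e} (M : SymMonoidal 𝒞) (fc : FC 𝒞 M) where
  open Category 𝒞
  open SymMonoidal M
  open FC fc
  open FCOps M fc
  open CategoryProperties 𝒞
  open SymMonoidalProperties M

  ⨁-resp-≈ : ∀ n {A B} {h h' : Fin n → A ⇒ B} → (∀ k → h k ≈ h' k) → ⨁ h ≈ ⨁ h'
  ⨁-resp-≈ zero          p = refl
  ⨁-resp-≈ (suc zero)    p = p zero
  ⨁-resp-≈ (suc (suc n)) p = p zero ⟩⊙⟨ ⨁-resp-≈ (suc n) (p ∘ suc)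

  ⨁-comp : ∀ n {A B C} (h : Fin n → A ⇒ B) (k : Fin n → B ⇒ C) →
           ⨁ h ⨾ ⨁ k ≈ ⨁ (λ j → h j ⨾ k j)
  ⨁-comp zero          h k = identityˡ
  ⨁-comp (suc zero)    h k = refl
  ⨁-comp (suc (suc n)) h k = sym ⊙-comp ⟨≈⟩ (refl ⟩⊙⟨ ⨁-comp (suc n) (h ∘ suc) (k ∘ suc))

  ∇ⁿ-nat : ∀ n {A B} (g : A ⇒ B) → ∇ⁿ n ⨾ g ≈ ⨁ {n} (λ _ → g) ⨾ ∇ⁿ n
  ∇ⁿ-nat zero          g = ¡-nat ⟨≈⟩ sym identityˡ
  ∇ⁿ-nat (suc zero)    g = sym id-comm
  ∇ⁿ-nat (suc (suc n)) g = begin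
    ((id ⊙₁ ∇ⁿ (suc n)) ⨾ ∇) ⨾ g
      ≈⟨ assoc ⟨≈⟩ (refl ⟩⨾⟨ ∇-nat) ⟨≈⟩ sym-assoc ⟩
    ((id ⊙₁ ∇ⁿ (suc n)) ⨾ (g ⊙₁ g)) ⨾ ∇
      ≈⟨ ⊙-square (sym id-comm) (∇ⁿ-nat (suc n) g) ⟩⨾⟨ refl ⟨≈⟩ assoc ⟩
    (g ⊙₁ ⨁ {suc n} (λ _ → g)) ⨾ (id ⊙₁ ∇ⁿ (suc n)) ⨾ ∇
      ∎

module DistributivityProperties {o ℓ e} {𝒞 : Category o ℓ e} {M⊗ M⊕ : SymMonoidal 𝒞}
                                (rig : RigAxioms 𝒞 M⊗ M⊕) (fc : FC 𝒞 M⊕) where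
  open Category 𝒞
  open RigAxioms rig
  open FC fc using (∇; ¡)
  open FCOps M⊕ fc using (_·_; ⨁; ∇ⁿ)
  open CategoryProperties 𝒞
  module ⊗ = SymMonoidal M⊗
  module ⊕ = SymMonoidal M⊕
  open ⊗ using () renaming (_⊙_ to _⊗_; _⊙₁_ to _⊗₁_)
  open ⊕ using () renaming (_⊙_ to _⊕_; _⊙₁_ to _⊕₁_)
  open SymMonoidalProperties M⊗ using (⊙id-comp; ⊙id-inverse) renaming (_⟩⊙⟨_ to _⟩⊗⟨_)
  open SymMonoidalProperties M⊕ using (⊙-square) renaming (_⟩⊙⟨_ to _⟩⊕⟨_)
  open CoproductProperties M⊕ fc using (¡-unique; ι₁; ι₂; ι₁-∇; ι₂-∇; ∇-unique)

  ¡⊗id : ∀ {A Z} → ¡ {A} ⊗₁ id {Z} ≈ λ• ⨾ ¡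
  ¡⊗id = sym (cancelˡ λ•-isoˡ) ⟨≈⟩ (refl ⟩⨾⟨ ¡-unique _)

  ι₁⊗id-δʳ : ∀ {A B Z} → (ι₁ {A} {B} ⊗₁ id {Z}) ⨾ δʳ ≈ ι₁
  ι₁⊗id-δʳ = begin
    (ι₁ ⊗₁ id) ⨾ δʳ
      ≈⟨ ⊙id-comp ⟩⨾⟨ refl ⟨≈⟩ assoc ⟨≈⟩ (refl ⟩⨾⟨ δʳ-nat) ⟩
    (⊕.runit⁻¹ ⊗₁ id) ⨾ δʳ ⨾ ((id ⊗₁ id) ⊕₁ (¡ ⊗₁ id))
      ≈⟨ refl ⟩⨾⟨ refl ⟩⨾⟨ ((⊗.⊙-id ⟨≈⟩ sym identityˡ) ⟩⊕⟨ ¡⊗id ⟨≈⟩ ⊕.⊙-comp) ⟩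
    (⊕.runit⁻¹ ⊗₁ id) ⨾ δʳ ⨾ (id ⊕₁ λ•) ⨾ (id ⊕₁ ¡)
      ≈⟨ refl ⟩⨾⟨ (sym-assoc ⟨≈⟩ (move-isoʳ (assoc ⟨≈⟩ lap-XVII) ⊕.runit-isoˡ ⟩⨾⟨ refl) ⟨≈⟩ assoc) ⟩
    (⊕.runit⁻¹ ⊗₁ id) ⨾ (⊕.runit ⊗₁ id) ⨾ ⊕.runit⁻¹ ⨾ (id ⊕₁ ¡)
      ≈⟨ cancelˡ (⊙id-inverse ⊕.runit-isoʳ) ⟩
    ι₁
      ∎

  ι₂⊗id-δʳ : ∀ {A B Z} → (ι₂ {A} {B} ⊗₁ id {Z}) ⨾ δʳ ≈ ι₂
  ι₂⊗id-δʳ = begin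
    (ι₂ ⊗₁ id) ⨾ δʳ
      ≈⟨ ⊙id-comp ⟩⨾⟨ refl ⟨≈⟩ assoc ⟨≈⟩ (refl ⟩⨾⟨ δʳ-nat) ⟩
    (⊕.lunit⁻¹ ⊗₁ id) ⨾ δʳ ⨾ ((¡ ⊗₁ id) ⊕₁ (id ⊗₁ id))
      ≈⟨ refl ⟩⨾⟨ refl ⟩⨾⟨ (¡⊗id ⟩⊕⟨ (⊗.⊙-id ⟨≈⟩ sym identityˡ) ⟨≈⟩ ⊕.⊙-comp) ⟩
    (⊕.lunit⁻¹ ⊗₁ id) ⨾ δʳ ⨾ (λ• ⊕₁ id) ⨾ (¡ ⊕₁ id)
      ≈⟨ refl ⟩⨾⟨ (sym-assoc ⟨≈⟩ (move-isoʳ (assoc ⟨≈⟩ lap-XV) ⊕.lunit-isoˡ ⟩⨾⟨ refl) ⟨≈⟩ assoc) ⟩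
    (⊕.lunit⁻¹ ⊗₁ id) ⨾ (⊕.lunit ⊗₁ id) ⨾ ⊕.lunit⁻¹ ⨾ (¡ ⊕₁ id)
      ≈⟨ cancelˡ (⊙id-inverse ⊕.lunit-isoʳ) ⟩
    ι₂
      ∎

  ∇⊗id : ∀ {A Z} → ∇ {A} ⊗₁ id {Z} ≈ δʳ ⨾ ∇
  ∇⊗id {A} {Z} = sym (cancelˡ δʳ-isoˡ) ⟨≈⟩ (refl ⟩⨾⟨ δʳ⁻¹-∇⊗id)
    where
    retract : {ι : A ⇒ A ⊕ A} {ι' : A ⊗ Z ⇒ (A ⊗ Z) ⊕ (A ⊗ Z)} →
              (ι ⊗₁ id) ⨾ δʳ ≈ ι' → ι ⨾ ∇ ≈ id → ι' ⨾ δʳ⁻¹ ⨾ (∇ ⊗₁ id) ≈ id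
    retract ιδ ι∇ = sym-assoc ⟨≈⟩ (sym (move-isoʳ ιδ δʳ-isoˡ) ⟩⨾⟨ refl)
                    ⟨≈⟩ sym ⊙id-comp ⟨≈⟩ (ι∇ ⟩⊗⟨ refl) ⟨≈⟩ ⊗.⊙-id
    δʳ⁻¹-∇⊗id : δʳ⁻¹ ⨾ (∇ ⊗₁ id) ≈ ∇
    δʳ⁻¹-∇⊗id = ∇-unique (retract ι₁⊗id-δʳ ι₁-∇) (retract ι₂⊗id-δʳ ι₂-∇)

  δʳ-sum : ∀ n {A Z} → (n · A) ⊗ Z ⇒ n · (A ⊗ Z)
  δʳ-sum zero          = λ•
  δʳ-sum (suc zero)    = id
  δʳ-sum (suc (suc n)) = δʳ ⨾ (id ⊕₁ δʳ-sum (suc n))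

  δʳ-sum-nat : ∀ n {A B Z U} (h : Fin n → A ⇒ B) (g : Z ⇒ U) →
               (⨁ h ⊗₁ g) ⨾ δʳ-sum n ≈ δʳ-sum n ⨾ ⨁ (λ k → h k ⊗₁ g)
  δʳ-sum-nat zero          h g = λ•-nat ⟨≈⟩ sym identityʳ
  δʳ-sum-nat (suc zero)    h g = id-comm
  δʳ-sum-nat (suc (suc n)) h g = begin
    ((h zero ⊕₁ ⨁ (h ∘ suc)) ⊗₁ g) ⨾ δʳ ⨾ (id ⊕₁ δʳ-sum (suc n))
      ≈⟨ sym-assoc ⟨≈⟩ (δʳ-nat ⟩⨾⟨ refl) ⟨≈⟩ assoc ⟩
    δʳ ⨾ ((h zero ⊗₁ g) ⊕₁ (⨁ (h ∘ suc) ⊗₁ g)) ⨾ (id ⊕₁ δʳ-sum (suc n))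
      ≈⟨ refl ⟩⨾⟨ ⊙-square id-comm (δʳ-sum-nat (suc n) (h ∘ suc) g) ⟨≈⟩ sym-assoc ⟩
    (δʳ ⨾ (id ⊕₁ δʳ-sum (suc n))) ⨾ ((h zero ⊗₁ g) ⊕₁ ⨁ (λ k → h (suc k) ⊗₁ g))
      ∎

  ∇ⁿ⊗id : ∀ n {A Z} → ∇ⁿ n {A} ⊗₁ id {Z} ≈ δʳ-sum n ⨾ ∇ⁿ n
  ∇ⁿ⊗id zero          = ¡⊗id
  ∇ⁿ⊗id (suc zero)    = ⊗.⊙-id ⟨≈⟩ sym identityˡ
  ∇ⁿ⊗id (suc (suc n)) = begin
    ((id ⊕₁ ∇ⁿ (suc n)) ⨾ ∇) ⊗₁ id
      ≈⟨ ⊙id-comp ⟨≈⟩ (refl ⟩⨾⟨ ∇⊗id) ⟨≈⟩ sym-assoc ⟩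
    (((id ⊕₁ ∇ⁿ (suc n)) ⊗₁ id) ⨾ δʳ) ⨾ ∇
      ≈⟨ δʳ-nat ⟩⨾⟨ refl ⟩
    (δʳ ⨾ ((id ⊗₁ id) ⊕₁ (∇ⁿ (suc n) ⊗₁ id))) ⨾ ∇
      ≈⟨ (refl ⟩⨾⟨ ((⊗.⊙-id ⟨≈⟩ sym identityˡ) ⟩⊕⟨ ∇ⁿ⊗id (suc n) ⟨≈⟩ ⊕.⊙-comp)) ⟩⨾⟨ refl ⟩
    (δʳ ⨾ (id ⊕₁ δʳ-sum (suc n)) ⨾ (id ⊕₁ ∇ⁿ (suc n))) ⨾ ∇
      ≈⟨ (sym-assoc ⟩⨾⟨ refl) ⟨≈⟩ assoc ⟩
    (δʳ ⨾ (id ⊕₁ δʳ-sum (suc n))) ⨾ (id ⊕₁ ∇ⁿ (suc n)) ⨾ ∇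
      ∎

module TermOperationProperties {T : Theory} {o ℓ e} (R : TRig T o ℓ e) where
  open TRig R using (𝒞; M⊗; M⊕; rig; fc; i)
  open TOps R
  open RigAxioms rig using (δʳ; δʳ-nat; λ•-nat; lap-VIII; lap-XI)
  open TMorphism i using (map)
  open CategoryProperties 𝒞
  module ⊗ = SymMonoidal M⊗
  module ⊕ = SymMonoidal M⊕
  open SymMonoidalProperties M⊗
    using (⊙id-comp; serializeˡ; serializeʳ; lunit⁻¹-nat; α-lunit; lunit⁻¹-α; σ-conjugate)
    renaming (_⟩⊙⟨_ to _⟩⊗⟨_)
  open SymMonoidalProperties M⊕ using (⊙-square)
  open SumProperties M⊕ fc
  open DistributivityProperties rig fc using (δʳ-sum; δʳ-sum-nat; ∇ⁿ⊗id)

  δʳⁿ-α : ∀ n {A Z} → (δʳⁿ n {A} ⊗₁ id {Z}) ⨾ δʳ-sum n ≈ ⊗.α ⨾ δʳⁿ n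
  δʳⁿ-α zero          = sym lap-XI
  δʳⁿ-α (suc zero)    = identityʳ ⟨≈⟩ sym α-lunit
  δʳⁿ-α (suc (suc n)) = begin
    ((δʳ ⨾ (λ⊗ ⊕₁ δʳⁿ (suc n))) ⊗₁ id) ⨾ δʳ ⨾ (id ⊕₁ δʳ-sum (suc n))
      ≈⟨ ⊙id-comp ⟩⨾⟨ refl ⟨≈⟩ assoc ⟨≈⟩ (refl ⟩⨾⟨ sym-assoc) ⟩
    (δʳ ⊗₁ id) ⨾ (((λ⊗ ⊕₁ δʳⁿ (suc n)) ⊗₁ id) ⨾ δʳ) ⨾ (id ⊕₁ δʳ-sum (suc n))
      ≈⟨ refl ⟩⨾⟨ (δʳ-nat ⟩⨾⟨ refl ⟨≈⟩ assoc) ⟩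
    (δʳ ⊗₁ id) ⨾ δʳ ⨾ ((λ⊗ ⊗₁ id) ⊕₁ (δʳⁿ (suc n) ⊗₁ id)) ⨾ (id ⊕₁ δʳ-sum (suc n))
      ≈⟨ refl ⟩⨾⟨ refl ⟩⨾⟨ ⊙-square (identityʳ ⟨≈⟩ sym α-lunit) (δʳⁿ-α (suc n)) ⟩
    (δʳ ⊗₁ id) ⨾ δʳ ⨾ (⊗.α ⊕₁ ⊗.α) ⨾ (λ⊗ ⊕₁ δʳⁿ (suc n))
      ≈⟨ refl ⟩⨾⟨ sym-assoc ⟨≈⟩ sym-assoc ⟨≈⟩ (lap-VIII ⟩⨾⟨ refl) ⟨≈⟩ assoc ⟩
    ⊗.α ⨾ δʳ ⨾ (λ⊗ ⊕₁ δʳⁿ (suc n))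
      ∎

  δʳⁿ-nat : ∀ n {A B} (g : A ⇒ B) → (id ⊗₁ g) ⨾ δʳⁿ n ≈ δʳⁿ n ⨾ ⨁ {n} (λ _ → g)
  δʳⁿ-nat zero          g = λ•-nat ⟨≈⟩ sym identityʳ
  δʳⁿ-nat (suc zero)    g = ⊗.lunit-nat
  δʳⁿ-nat (suc (suc n)) g = begin
    (id ⊗₁ g) ⨾ δʳ ⨾ (λ⊗ ⊕₁ δʳⁿ (suc n))
      ≈⟨ sym-assoc ⟨≈⟩ (((sym ⊕.⊙-id ⟩⊗⟨ refl) ⟩⨾⟨ refl ⟨≈⟩ δʳ-nat) ⟩⨾⟨ refl) ⟨≈⟩ assoc ⟩
    δʳ ⨾ ((id ⊗₁ g) ⊕₁ (id ⊗₁ g)) ⨾ (λ⊗ ⊕₁ δʳⁿ (suc n))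
      ≈⟨ refl ⟩⨾⟨ ⊙-square ⊗.lunit-nat (δʳⁿ-nat (suc n) g) ⟨≈⟩ sym-assoc ⟩
    (δʳ ⨾ (λ⊗ ⊕₁ δʳⁿ (suc n))) ⨾ (g ⊕₁ ⨁ {suc n} (λ _ → g))
      ∎

  tX-nat : ∀ {n} (t : LArr T n 1) {A B} (g : A ⇒ B) → g ⨾ tX t ≈ tX t ⨾ ⨁ {n} (λ _ → g)
  tX-nat {n} t g = begin
    g ⨾ λ⊗⁻¹ ⨾ (map t ⊗₁ id) ⨾ δʳⁿ n
      ≈⟨ sym-assoc ⟨≈⟩ (lunit⁻¹-nat ⟩⨾⟨ refl) ⟨≈⟩ assoc ⟩
    λ⊗⁻¹ ⨾ (id ⊗₁ g) ⨾ (map t ⊗₁ id) ⨾ δʳⁿ n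
      ≈⟨ refl ⟩⨾⟨ (sym-assoc ⟨≈⟩ ((sym serializeʳ ⟨≈⟩ serializeˡ) ⟩⨾⟨ refl) ⟨≈⟩ assoc) ⟩
    λ⊗⁻¹ ⨾ (map t ⊗₁ id) ⨾ (id ⊗₁ g) ⨾ δʳⁿ n
      ≈⟨ refl ⟩⨾⟨ refl ⟩⨾⟨ δʳⁿ-nat n g ⟩
    λ⊗⁻¹ ⨾ (map t ⊗₁ id) ⨾ δʳⁿ n ⨾ ⨁ {n} (λ _ → g)
      ≈⟨ refl ⟩⨾⟨ sym-assoc ⟨≈⟩ sym-assoc ⟩
    tX t ⨾ ⨁ {n} (λ _ → g)
      ∎

  tX⊗id : ∀ {n} (t : LArr T n 1) {A Z} → (tX t {A} ⊗₁ id {Z}) ⨾ δʳ-sum n ≈ tX t {A ⊗ Z}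
  tX⊗id {n} t = begin
    ((λ⊗⁻¹ ⨾ (map t ⊗₁ id) ⨾ δʳⁿ n) ⊗₁ id) ⨾ δʳ-sum n
      ≈⟨ (⊙id-comp ⟨≈⟩ (refl ⟩⨾⟨ ⊙id-comp)) ⟩⨾⟨ refl ⟨≈⟩ assoc ⟨≈⟩ (refl ⟩⨾⟨ assoc) ⟩
    (λ⊗⁻¹ ⊗₁ id) ⨾ ((map t ⊗₁ id) ⊗₁ id) ⨾ (δʳⁿ n ⊗₁ id) ⨾ δʳ-sum n
      ≈⟨ refl ⟩⨾⟨ refl ⟩⨾⟨ δʳⁿ-α n ⟩
    (λ⊗⁻¹ ⊗₁ id) ⨾ ((map t ⊗₁ id) ⊗₁ id) ⨾ ⊗.α ⨾ δʳⁿ n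
      ≈⟨ refl ⟩⨾⟨ (sym-assoc ⟨≈⟩ (⊗.α-nat ⟩⨾⟨ refl) ⟨≈⟩ assoc) ⟩
    (λ⊗⁻¹ ⊗₁ id) ⨾ ⊗.α ⨾ (map t ⊗₁ (id ⊗₁ id)) ⨾ δʳⁿ n
      ≈⟨ sym-assoc ⟨≈⟩ (lunit⁻¹-α ⟩⨾⟨ (refl ⟩⊗⟨ ⊗.⊙-id) ⟩⨾⟨ refl) ⟩
    λ⊗⁻¹ ⨾ (map t ⊗₁ id) ⨾ δʳⁿ n
      ∎

  tApp-resp-≈ : ∀ {n} (t : LArr T n 1) {A B} {h h' : Fin n → A ⇒ B} →
                (∀ k → h k ≈ h' k) → tApp t h ≈ tApp t h'
  tApp-resp-≈ {n} t p = refl ⟩⨾⟨ ⨁-resp-≈ n p ⟩⨾⟨ refl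

  tApp-postcomp : ∀ {n} (t : LArr T n 1) {A B C} (h : Fin n → A ⇒ B) (g : B ⇒ C) →
                  tApp t h ⨾ g ≈ tApp t (λ k → h k ⨾ g)
  tApp-postcomp {n} t h g = begin
    (tX t ⨾ ⨁ h ⨾ ∇ⁿ n) ⨾ g                ≈⟨ assoc ⟨≈⟩ (refl ⟩⨾⟨ assoc) ⟩
    tX t ⨾ ⨁ h ⨾ ∇ⁿ n ⨾ g                  ≈⟨ refl ⟩⨾⟨ refl ⟩⨾⟨ ∇ⁿ-nat n g ⟩
    tX t ⨾ ⨁ h ⨾ ⨁ {n} (λ _ → g) ⨾ ∇ⁿ n    ≈⟨ refl ⟩⨾⟨ (sym-assoc ⟨≈⟩ (⨁-comp n h _ ⟩⨾⟨ refl)) ⟩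
    tApp t (λ k → h k ⨾ g)                 ∎

  tApp-precomp : ∀ {n} (t : LArr T n 1) {W A B} (h : Fin n → A ⇒ B) (g : W ⇒ A) →
                 g ⨾ tApp t h ≈ tApp t (λ k → g ⨾ h k)
  tApp-precomp {n} t h g = begin
    g ⨾ tX t ⨾ ⨁ h ⨾ ∇ⁿ n                  ≈⟨ sym-assoc ⟨≈⟩ (tX-nat t g ⟩⨾⟨ refl) ⟨≈⟩ assoc ⟩
    tX t ⨾ ⨁ {n} (λ _ → g) ⨾ ⨁ h ⨾ ∇ⁿ n    ≈⟨ refl ⟩⨾⟨ (sym-assoc ⟨≈⟩ (⨁-comp n _ h ⟩⨾⟨ refl)) ⟩
    tApp t (λ k → g ⨾ h k)                 ∎

  tApp-⊗ʳ : ∀ {n} (t : LArr T n 1) {A B Z U} (h : Fin n → A ⇒ B) (g : Z ⇒ U) →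
            tApp t h ⊗₁ g ≈ tApp t (λ k → h k ⊗₁ g)
  tApp-⊗ʳ {n} t h g = begin
    (tX t ⨾ ⨁ h ⨾ ∇ⁿ n) ⊗₁ g
      ≈⟨ refl ⟩⊗⟨ (sym identityˡ ⟨≈⟩ (refl ⟩⨾⟨ sym identityʳ)) ⟩
    (tX t ⨾ ⨁ h ⨾ ∇ⁿ n) ⊗₁ (id ⨾ g ⨾ id)
      ≈⟨ ⊗.⊙-comp ⟨≈⟩ (refl ⟩⨾⟨ ⊗.⊙-comp) ⟩
    (tX t ⊗₁ id) ⨾ (⨁ h ⊗₁ g) ⨾ (∇ⁿ n ⊗₁ id)
      ≈⟨ refl ⟩⨾⟨ refl ⟩⨾⟨ ∇ⁿ⊗id n ⟩
    (tX t ⊗₁ id) ⨾ (⨁ h ⊗₁ g) ⨾ δʳ-sum n ⨾ ∇ⁿ n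
      ≈⟨ refl ⟩⨾⟨ (sym-assoc ⟨≈⟩ (δʳ-sum-nat n h g ⟩⨾⟨ refl) ⟨≈⟩ assoc) ⟩
    (tX t ⊗₁ id) ⨾ δʳ-sum n ⨾ ⨁ (λ k → h k ⊗₁ g) ⨾ ∇ⁿ n
      ≈⟨ sym-assoc ⟨≈⟩ (tX⊗id t ⟩⨾⟨ refl) ⟩
    tApp t (λ k → h k ⊗₁ g)
      ∎

  tApp-⊗ˡ : ∀ {n} (t : LArr T n 1) {A B Z U} (h : Fin n → A ⇒ B) (g : Z ⇒ U) →
            g ⊗₁ tApp t h ≈ tApp t (λ k → g ⊗₁ h k)
  tApp-⊗ˡ {n} t h g = begin
    g ⊗₁ tApp t h
      ≈⟨ σ-conjugate ⟩
    ⊗.σ ⨾ (tApp t h ⊗₁ g) ⨾ ⊗.σ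
      ≈⟨ refl ⟩⨾⟨ (tApp-⊗ʳ t h g ⟩⨾⟨ refl ⟨≈⟩ tApp-postcomp t _ ⊗.σ) ⟩
    ⊗.σ ⨾ tApp t (λ k → (h k ⊗₁ g) ⨾ ⊗.σ)
      ≈⟨ tApp-precomp t _ ⊗.σ ⟩
    tApp t (λ k → ⊗.σ ⨾ (h k ⊗₁ g) ⨾ ⊗.σ)
      ≈⟨ tApp-resp-≈ t (λ k → sym σ-conjugate) ⟩
    tApp t (λ k → g ⊗₁ h k)
      ∎

proposition39 : ∀ (T : Theory) {o ℓ e} (R : TRig T o ℓ e) {n : _} (t : LArr T n 1) →
    let open TOps R in
      (∀ {X Y Z} (h : Fin n → X ⇒ Y) (g : Y ⇒ Z) →
         tApp t h ⨾ g ≈ tApp t (λ k → h k ⨾ g))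
    × (∀ {W X Y} (h : Fin n → X ⇒ Y) (g : W ⇒ X) →
         g ⨾ tApp t h ≈ tApp t (λ k → g ⨾ h k))
    × (∀ {X Y Z U} (h : Fin n → X ⇒ Y) (g : Z ⇒ U) →
         tApp t h ⊗₁ g ≈ tApp t (λ k → h k ⊗₁ g))
    × (∀ {X Y Z U} (h : Fin n → X ⇒ Y) (g : Z ⇒ U) →
         g ⊗₁ tApp t h ≈ tApp t (λ k → g ⊗₁ h k))
proposition39 T R t = tApp-postcomp t , tApp-precomp t , tApp-⊗ʳ t , tApp-⊗ˡ t
  where open TermOperationProperties R
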